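{- Let $d\ge 2$ be an integer (in the paper's notation $d=m_1-m_2$ with $m_1\ge m_2+2$). Let \[ G(z,q)=\sum_{p} z^{\mathrm{len}(p)}\,q^{N(p)}, \] where the sum runs over all lattice paths $p$ with steps $(1,1)$ and $(1,-1)$ (of any length $\mathrm{len}(p)$) starting at $(0,0)$ and ending at height $-d$, and $N(p)$ is the number of downward steps $(1,-1)$ of $p$ that end at height $-1$ or at height $-2$. Then \[ G(z,q)=\frac{q^2}{1-2z^2qE(z)}\,\big(zE(z)\big)^{d},\qquad E(z)=\frac{1-\sqrt{1-4z^2}}{2z^2}. \] In particular, the coefficient of $z^{m_1+m_2}$ in $G(z,q)$, with $d=m_1-m_2$, is the generating polynomial of such paths of length $m_1+m_2$ ending at height $m_2-m_1$, counted by $N(p)$.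
   Context: $E(z)$ is the generating function of Dyck excursions (paths with steps $(1,\pm1)$ from height $0$ to height $0$ never going below height $0$), counted by length. -}

module Defs where

open import Data.Nat using (ℕ; zero; suc; _+_; _*_; _∸_)
open import Data.Integer as ℤ using (ℤ; +_; -[1+_])
open import Data.List using (List; []; _∷_; length; filter; map; concatMap)
open import Data.Bool using (Bool; true; false; _∧_; _∨_; if_then_else_)
open import Relation.Binary.PropositionalEquality using (_≡_)
open import Relation.Nullary.Decidable using (Dec; yes; no)

-- Lattice paths: sequences of steps (1,1) = up, (1,-1) = down, starting at (0,0).
data Step : Set where
  up down : Step

Path : Set
Path = List Step

allPaths : ℕ → List Path
allPaths zero = [] ∷ []
allPaths (suc n) = concatMap (λ p → (up ∷ p) ∷ (down ∷ p) ∷ []) (allPaths n)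

stepVal : Step → ℤ
stepVal up = + 1
stepVal down = -[1+ 0 ]

endFrom : ℤ → Path → ℤ
endFrom h [] = h
endFrom h (s ∷ p) = endFrom (h ℤ.+ stepVal s) p

endHeight : Path → ℤ
endHeight = endFrom (+ 0)

isMinus1or2 : ℤ → Bool
isMinus1or2 -[1+ 0 ] = true
isMinus1or2 -[1+ 1 ] = true
isMinus1or2 _ = false

NFrom : ℤ → Path → ℕ
NFrom h [] = 0
NFrom h (up ∷ p) = NFrom (h ℤ.+ + 1) p
NFrom h (down ∷ p) =
  (if isMinus1or2 (h ℤ.- + 1) then 1 else 0) + NFrom (h ℤ.- + 1) p

N : Path → ℕ
N = NFrom (+ 0)

staysNonneg : ℤ → Path → Bool
staysNonneg h [] = true
staysNonneg h (s ∷ p) with h ℤ.+ stepVal s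
... | -[1+ _ ] = false
... | h' = staysNonneg h' p

isZero : ℤ → Bool
isZero (+ 0) = true
isZero _ = false

isHeight : ℤ → ℤ → Bool
isHeight a b with a ℤ.≟ b
... | yes _ = true
... | no _ = false

natEq : ℕ → ℕ → Bool
natEq m n with m Data.Nat.≟ n
... | yes _ = true
... | no _ = false

count : {A : Set} → (A → Bool) → List A → ℕ
count P [] = 0
count P (x ∷ xs) = (if P x then 1 else 0) + count P xs

-- Bivariate formal power series in z, q with ℕ coefficients:
-- F n k = coefficient of z^n q^k.
FPS2 : Set
FPS2 = ℕ → ℕ → ℕ

G : ℕ → FPS2
G d n k = count (λ p → isHeight (endHeight p) (ℤ.- (+ d)) ∧ natEq (N p) k) (allPaths n)

-- Coefficients of E(z): number of Dyck excursions of length n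
Ecoeff : ℕ → ℕ
Ecoeff n = count (λ p → staysNonneg (+ 0) p ∧ isZero (endHeight p)) (allPaths n)

sumTo : ℕ → (ℕ → ℕ) → ℕ
sumTo zero f = f 0
sumTo (suc n) f = sumTo n f + f (suc n)

_⊛_ : FPS2 → FPS2 → FPS2
(f ⊛ g) n k = sumTo n (λ i → sumTo k (λ j → f i j * g (n ∸ i) (k ∸ j)))

one : FPS2
one zero zero = 1
one _ _ = 0

_^ₛ_ : FPS2 → ℕ → FPS2
f ^ₛ zero = one
f ^ₛ suc m = f ⊛ (f ^ₛ m)

q² : FPS2
q² zero 2 = 1
q² _ _ = 0

zE : FPS2
zE zero _ = 0
zE (suc n) zero = Ecoeff n
zE (suc n) (suc _) = 0

twoZ²qE : FPS2
twoZ²qE (suc (suc n)) 1 = 2 * Ecoeff n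
twoZ²qE _ _ = 0

-- 1/(1 - X) = Σ_j X^j for a series X with no z^0 terms (here X = 2z²qE);
-- the coefficient of z^n only receives contributions from j ≤ n.
geom : FPS2 → FPS2
geom X n k = sumTo n (λ j → (X ^ₛ j) n k)

RHS : ℕ → FPS2
RHS d = (q² ⊛ geom twoZ²qE) ⊛ (zE ^ₛ d)

module Submission where

-- Read every path off by its last step. Writing P(t,k) for the series Σ zⁿ counting paths of
-- length n that end at height t and have N = k, the last step gives
--   P(t,k) = z P(t-1,k) + z P(t+1, k - [t ∈ {-1,-2}]),
-- and each P(t,k) is 0 or a single term c zᵐ Eᵖ; for instance P(-d, j+2) = 2ʲ z^(d+2j) E^(d+j).
-- Checking that these terms satisfy the recursion only uses E = 1 + z²E², which in turn comes from
-- the first-step decomposition of nonnegative paths from height h to 0, counted by zʰ Eʰ⁺¹.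
-- Finally 2ʲ z^(d+2j) E^(d+j) is exactly the q^(j+2)-coefficient of q²/(1 - 2z²qE) · (zE)ᵈ.

open import Defs
open import Data.Nat using (ℕ; _≤_)
open import Relation.Binary.PropositionalEquality using (_≡_)

open import Data.Nat as ℕ using (zero; suc; _+_; _*_; _∸_; _^_; _<_; z≤n; s≤s; z<s)
open import Data.Nat.Properties
open import Algebra.Properties.CommutativeSemigroup +-commutativeSemigroup using (interchange)
open import Data.Integer as ℤ using (ℤ; +_; -[1+_])
import Data.Integer.Properties as ℤ
open import Data.List using (List; []; _∷_; _∷ʳ_; concatMap)
open import Data.Bool using (Bool; true; false; _∧_; if_then_else_)
open import Data.Bool.Properties using (∧-zeroʳ)
open import Data.Empty using (⊥-elim)
open import Function using (_∘_)
open import Data.Sum using (inj₁; inj₂)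
open import Relation.Binary.PropositionalEquality
  using (_≢_; _≗_; refl; sym; trans; cong; cong₂; subst; module ≡-Reasoning)
open import Relation.Nullary using (Dec; yes; no)

sumTo-cong : ∀ n {f g : ℕ → ℕ} → (∀ i → i ≤ n → f i ≡ g i) → sumTo n f ≡ sumTo n g
sumTo-cong zero e = e 0 z≤n
sumTo-cong (suc n) e =
  cong₂ _+_ (sumTo-cong n (λ i i≤n → e i (m≤n⇒m≤1+n i≤n))) (e (suc n) ≤-refl)

sumTo-zero : ∀ n {f : ℕ → ℕ} → (∀ i → i ≤ n → f i ≡ 0) → sumTo n f ≡ 0
sumTo-zero zero e = e 0 z≤n
sumTo-zero (suc n) e =
  cong₂ _+_ (sumTo-zero n (λ i i≤n → e i (m≤n⇒m≤1+n i≤n))) (e (suc n) ≤-refl)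

sumTo-+ : ∀ n (f g : ℕ → ℕ) → sumTo n (λ i → f i + g i) ≡ sumTo n f + sumTo n g
sumTo-+ zero f g = refl
sumTo-+ (suc n) f g =
  trans (cong (_+ (f (suc n) + g (suc n))) (sumTo-+ n f g))
        (interchange (sumTo n f) (sumTo n g) (f (suc n)) (g (suc n)))

sumTo-*ˡ : ∀ n c (f : ℕ → ℕ) → sumTo n (λ i → c * f i) ≡ c * sumTo n f
sumTo-*ˡ zero c f = refl
sumTo-*ˡ (suc n) c f =
  trans (cong (_+ c * f (suc n)) (sumTo-*ˡ n c f)) (sym (*-distribˡ-+ c (sumTo n f) (f (suc n))))

sumTo-sucˡ : ∀ n (f : ℕ → ℕ) → sumTo (suc n) f ≡ f 0 + sumTo n (λ i → f (suc i))
sumTo-sucˡ zero f = refl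
sumTo-sucˡ (suc n) f = trans (cong (_+ f (suc (suc n))) (sumTo-sucˡ n f)) (+-assoc (f 0) _ _)

sumTo-reverse : ∀ n (f : ℕ → ℕ) → sumTo n f ≡ sumTo n (λ i → f (n ∸ i))
sumTo-reverse zero f = refl
sumTo-reverse (suc n) f = begin
  sumTo n f + f (suc n)                  ≡⟨ +-comm (sumTo n f) _ ⟩
  f (suc n) + sumTo n f                  ≡⟨ cong (_+_ (f (suc n))) (sumTo-reverse n f) ⟩
  f (suc n) + sumTo n (λ i → f (n ∸ i))  ≡⟨ sym (sumTo-sucˡ n (λ i → f (suc n ∸ i))) ⟩
  sumTo (suc n) (λ i → f (suc n ∸ i))    ∎
  where open ≡-Reasoning

sumTo-single : ∀ n a {f : ℕ → ℕ} → a ≤ n → (∀ i → i ≤ n → i ≢ a → f i ≡ 0) → sumTo n f ≡ f a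
sumTo-single zero .zero z≤n e = refl
sumTo-single (suc n) a {f} a≤1+n e with m≤n⇒m<n∨m≡n a≤1+n
... | inj₁ (s≤s a≤n) =
  trans (cong₂ _+_ (sumTo-single n a a≤n (λ i i≤n → e i (m≤n⇒m≤1+n i≤n)))
                   (e (suc n) ≤-refl (λ 1+n≡a → <⇒≢ (s≤s a≤n) (sym 1+n≡a))))
        (+-identityʳ _)
... | inj₂ refl =
  cong (_+ f (suc n)) (sumTo-zero n (λ i i≤n → e i (m≤n⇒m≤1+n i≤n) (<⇒≢ (s≤s i≤n))))

-- Power series in z

Series : Set
Series = ℕ → ℕ

infixl 6 _⊕_
infixr 7 _·_
infixl 7 _∗_

_⊕_ : Series → Series → Series
(f ⊕ g) n = f n + g n

_·_ : ℕ → Series → Series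
(c · f) n = c * f n

_∗_ : Series → Series → Series
(f ∗ g) n = sumTo n (λ i → f i * g (n ∸ i))

δ : Series
δ zero = 1
δ (suc _) = 0

shift : ℕ → Series → Series
shift zero f = f
shift (suc m) f zero = 0
shift (suc m) f (suc n) = shift m f n

_^∗_ : Series → ℕ → Series
f ^∗ zero = δ
f ^∗ suc p = f ∗ f ^∗ p

∗-cong : ∀ {f f′ g g′} → f ≗ f′ → g ≗ g′ → f ∗ g ≗ f′ ∗ g′
∗-cong f≗f′ g≗g′ n = sumTo-cong n (λ i _ → cong₂ _*_ (f≗f′ i) (g≗g′ (n ∸ i)))

∗-congʳ-upTo : ∀ f {g g′} n → (∀ i → i ≤ n → g i ≡ g′ i) → (f ∗ g) n ≡ (f ∗ g′) n
∗-congʳ-upTo f n g≡g′ = sumTo-cong n (λ i _ → cong (f i *_) (g≡g′ (n ∸ i) (m∸n≤m n i)))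

∗-comm : ∀ f g → f ∗ g ≗ g ∗ f
∗-comm f g n = trans (sumTo-reverse n _) (sumTo-cong n λ i i≤n →
  trans (cong (λ j → f (n ∸ i) * g j) (m∸[m∸n]≡n i≤n)) (*-comm (f (n ∸ i)) (g i)))

∗-identityʳ : ∀ f → f ∗ δ ≗ f
∗-identityʳ f n = trans (sumTo-single n n ≤-refl off-diagonal)
                        (trans (cong (λ j → f n * δ j) (n∸n≡0 n)) (*-identityʳ (f n)))
  where
  off-diagonal : ∀ i → i ≤ n → i ≢ n → f i * δ (n ∸ i) ≡ 0
  off-diagonal i i≤n i≢n with n ∸ i in eq
  ... | zero = ⊥-elim (i≢n (≤-antisym i≤n (m∸n≡0⇒m≤n eq)))
  ... | suc _ = *-zeroʳ (f i)

∗-identityˡ : ∀ f → δ ∗ f ≗ f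
∗-identityˡ f n = trans (∗-comm δ f n) (∗-identityʳ f n)

∗-zeroˡ : ∀ f → (λ _ → 0) ∗ f ≗ (λ _ → 0)
∗-zeroˡ f n = sumTo-zero n (λ _ _ → refl)

∗-distribʳ-⊕ : ∀ f g h → (f ⊕ g) ∗ h ≗ f ∗ h ⊕ g ∗ h
∗-distribʳ-⊕ f g h n =
  trans (sumTo-cong n (λ i _ → *-distribʳ-+ (h (n ∸ i)) (f i) (g i))) (sumTo-+ n _ _)

∗-scaleˡ : ∀ c f g → (c · f) ∗ g ≗ c · (f ∗ g)
∗-scaleˡ c f g n = trans (sumTo-cong n (λ i _ → *-assoc c (f i) (g (n ∸ i)))) (sumTo-*ˡ n c _)

∗-scaleʳ : ∀ c f g → f ∗ (c · g) ≗ c · (f ∗ g)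
∗-scaleʳ c f g n =
  trans (∗-comm f (c · g) n) (trans (∗-scaleˡ c g f n) (cong (c *_) (∗-comm g f n)))

shift-cong : ∀ m {f g} → f ≗ g → shift m f ≗ shift m g
shift-cong zero f≗g n = f≗g n
shift-cong (suc m) f≗g zero = refl
shift-cong (suc m) f≗g (suc n) = shift-cong m f≗g n

shift-cong-upTo : ∀ m {f g} n → (∀ i → i ≤ n → f i ≡ g i) → shift m f n ≡ shift m g n
shift-cong-upTo zero n f≡g = f≡g n ≤-refl
shift-cong-upTo (suc m) zero f≡g = refl
shift-cong-upTo (suc m) (suc n) f≡g = shift-cong-upTo m n (λ i i≤n → f≡g i (m≤n⇒m≤1+n i≤n))

shift-⊕ : ∀ m f g → shift m (f ⊕ g) ≗ shift m f ⊕ shift m g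
shift-⊕ zero f g n = refl
shift-⊕ (suc m) f g zero = refl
shift-⊕ (suc m) f g (suc n) = shift-⊕ m f g n

shift-shift : ∀ m m′ f → shift m (shift m′ f) ≗ shift (m + m′) f
shift-shift zero m′ f n = refl
shift-shift (suc m) m′ f zero = refl
shift-shift (suc m) m′ f (suc n) = shift-shift m m′ f n

shift-∗ : ∀ m f g → shift m f ∗ g ≗ shift m (f ∗ g)
shift-∗ zero f g n = refl
shift-∗ (suc m) f g zero = refl
shift-∗ (suc m) f g (suc n) = trans (sumTo-sucˡ n _) (shift-∗ m f g n)

shift-∗-shift : ∀ m m′ f g → shift m f ∗ shift m′ g ≗ shift (m + m′) (f ∗ g)
shift-∗-shift m m′ f g n = begin
  (shift m f ∗ shift m′ g) n    ≡⟨ shift-∗ m f (shift m′ g) n ⟩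
  shift m (f ∗ shift m′ g) n    ≡⟨ shift-cong m f∗shift≗shift∗ n ⟩
  shift m (shift m′ (f ∗ g)) n  ≡⟨ shift-shift m m′ (f ∗ g) n ⟩
  shift (m + m′) (f ∗ g) n      ∎
  where
  open ≡-Reasoning
  f∗shift≗shift∗ : f ∗ shift m′ g ≗ shift m′ (f ∗ g)
  f∗shift≗shift∗ i = trans (∗-comm f (shift m′ g) i)
                           (trans (shift-∗ m′ g f i) (shift-cong m′ (∗-comm g f) i))

∗-unfoldˡ : ∀ f g → f ∗ g ≗ f 0 · g ⊕ shift 1 ((f ∘ suc) ∗ g)
∗-unfoldˡ f g zero = sym (+-identityʳ (f 0 * g 0))
∗-unfoldˡ f g (suc n) = sumTo-sucˡ n _

∗-assoc : ∀ f g h → (f ∗ g) ∗ h ≗ f ∗ (g ∗ h)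
∗-assoc f g h n = begin
  ((f ∗ g) ∗ h) n                                 ≡⟨ ∗-cong {g = h} (∗-unfoldˡ f g) (λ _ → refl) n ⟩
  ((f 0 · g ⊕ shift 1 ((f ∘ suc) ∗ g)) ∗ h) n     ≡⟨ ∗-distribʳ-⊕ (f 0 · g) _ h n ⟩
  ((f 0 · g) ∗ h) n + (shift 1 ((f ∘ suc) ∗ g) ∗ h) n
    ≡⟨ cong₂ _+_ (∗-scaleˡ (f 0) g h n) (shift-∗ 1 ((f ∘ suc) ∗ g) h n) ⟩
  f 0 * (g ∗ h) n + shift 1 (((f ∘ suc) ∗ g) ∗ h) n ≡⟨ cong (_+_ (f 0 * (g ∗ h) n)) (tail-assoc n) ⟩
  f 0 * (g ∗ h) n + shift 1 ((f ∘ suc) ∗ (g ∗ h)) n ≡⟨ sym (∗-unfoldˡ f (g ∗ h) n) ⟩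
  (f ∗ (g ∗ h)) n                                 ∎
  where
  open ≡-Reasoning
  tail-assoc : shift 1 (((f ∘ suc) ∗ g) ∗ h) ≗ shift 1 ((f ∘ suc) ∗ (g ∗ h))
  tail-assoc zero = refl
  tail-assoc (suc m) = ∗-assoc (f ∘ suc) g h m

^∗-+ : ∀ f p q → f ^∗ p ∗ f ^∗ q ≗ f ^∗ (p + q)
^∗-+ f zero q = ∗-identityˡ (f ^∗ q)
^∗-+ f (suc p) q n =
  trans (∗-assoc f (f ^∗ p) (f ^∗ q) n) (∗-cong {f = f} (λ _ → refl) (^∗-+ f p q) n)

ind : Bool → ℕ
ind b = if b then 1 else 0

count-cong : ∀ {A : Set} {P Q : A → Bool} xs → (∀ x → P x ≡ Q x) → count P xs ≡ count Q xs
count-cong [] P≡Q = refl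
count-cong (x ∷ xs) P≡Q = cong₂ (λ b n → ind b + n) (P≡Q x) (count-cong xs P≡Q)

count-false : ∀ {A : Set} {P : A → Bool} xs → (∀ x → P x ≡ false) → count P xs ≡ 0
count-false [] P≡false = refl
count-false (x ∷ xs) P≡false rewrite P≡false x = count-false xs P≡false

count-allPaths-suc : ∀ n (P : Path → Bool) →
  count P (allPaths (suc n)) ≡ count (P ∘ (up ∷_)) (allPaths n) + count (P ∘ (down ∷_)) (allPaths n)
count-allPaths-suc n P = go (allPaths n)
  where
  go : ∀ ps → count P (concatMap (λ p → (up ∷ p) ∷ (down ∷ p) ∷ []) ps)
              ≡ count (P ∘ (up ∷_)) ps + count (P ∘ (down ∷_)) ps
  go [] = refl
  go (p ∷ ps) = begin
    u + (d + count P rest)                 ≡⟨ sym (+-assoc u d _) ⟩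
    (u + d) + count P rest                 ≡⟨ cong (_+_ (u + d)) (go ps) ⟩
    (u + d) + (count (P ∘ (up ∷_)) ps + count (P ∘ (down ∷_)) ps)
                                           ≡⟨ interchange u d _ _ ⟩
    (u + count (P ∘ (up ∷_)) ps) + (d + count (P ∘ (down ∷_)) ps) ∎
    where
    open ≡-Reasoning
    u d : ℕ
    u = ind (P (up ∷ p))
    d = ind (P (down ∷ p))
    rest : List Path
    rest = concatMap (λ p → (up ∷ p) ∷ (down ∷ p) ∷ []) ps

count-allPaths-∷ʳ : ∀ n (P : Path → Bool) →
  count P (allPaths (suc n))
    ≡ count (λ p → P (p ∷ʳ up)) (allPaths n) + count (λ p → P (p ∷ʳ down)) (allPaths n)
count-allPaths-∷ʳ zero P = cong (_+ (ind (P (down ∷ [])) + 0)) (sym (+-identityʳ (ind (P (up ∷ [])))))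
count-allPaths-∷ʳ (suc n) P = begin
  count P (allPaths (suc (suc n)))
    ≡⟨ count-allPaths-suc (suc n) P ⟩
  count (P ∘ (up ∷_)) (allPaths (suc n)) + count (P ∘ (down ∷_)) (allPaths (suc n))
    ≡⟨ cong₂ _+_ (count-allPaths-∷ʳ n (P ∘ (up ∷_))) (count-allPaths-∷ʳ n (P ∘ (down ∷_))) ⟩
  (C (λ p → up ∷ p ∷ʳ up) + C (λ p → up ∷ p ∷ʳ down))
    + (C (λ p → down ∷ p ∷ʳ up) + C (λ p → down ∷ p ∷ʳ down))
    ≡⟨ interchange (C (λ p → up ∷ p ∷ʳ up)) _ _ _ ⟩
  (C (λ p → up ∷ p ∷ʳ up) + C (λ p → down ∷ p ∷ʳ up))
    + (C (λ p → up ∷ p ∷ʳ down) + C (λ p → down ∷ p ∷ʳ down))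
    ≡⟨ sym (cong₂ _+_ (count-allPaths-suc n (λ p → P (p ∷ʳ up)))
                      (count-allPaths-suc n (λ p → P (p ∷ʳ down)))) ⟩
  count (λ p → P (p ∷ʳ up)) (allPaths (suc n)) + count (λ p → P (p ∷ʳ down)) (allPaths (suc n)) ∎
  where
  open ≡-Reasoning
  C : (Path → Path) → ℕ
  C f = count (P ∘ f) (allPaths n)

-- The Catalan equation E = 1 + z²E²

catalanMap : Series → Series
catalanMap f = δ ⊕ shift 2 (f ∗ f)

^∗-step-upTo : ∀ f n → (∀ i → i ≤ n → f i ≡ catalanMap f i) →
               ∀ p → (f ^∗ suc p) n ≡ (f ^∗ p ⊕ shift 2 (f ^∗ suc (suc p))) n
^∗-step-upTo f n f≡ p = begin
  (f ∗ f ^∗ p) n                                   ≡⟨ ∗-comm f (f ^∗ p) n ⟩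
  (f ^∗ p ∗ f) n                                   ≡⟨ ∗-congʳ-upTo (f ^∗ p) n f≡ ⟩
  (f ^∗ p ∗ catalanMap f) n                        ≡⟨ ∗-comm (f ^∗ p) (catalanMap f) n ⟩
  (catalanMap f ∗ f ^∗ p) n                        ≡⟨ ∗-distribʳ-⊕ δ (shift 2 (f ∗ f)) (f ^∗ p) n ⟩
  (δ ∗ f ^∗ p) n + (shift 2 (f ∗ f) ∗ f ^∗ p) n
    ≡⟨ cong₂ _+_ (∗-identityˡ (f ^∗ p) n) (shift-∗ 2 (f ∗ f) (f ^∗ p) n) ⟩
  (f ^∗ p) n + shift 2 ((f ∗ f) ∗ f ^∗ p) n
    ≡⟨ cong (_+_ ((f ^∗ p) n)) (shift-cong 2 (∗-assoc f f (f ^∗ p)) n) ⟩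
  (f ^∗ p ⊕ shift 2 (f ^∗ suc (suc p))) n          ∎
  where open ≡-Reasoning

E : Series
E = Ecoeff

returns : ℕ → Series
returns h n = count (λ p → staysNonneg (+ h) p ∧ isZero (endFrom (+ h) p)) (allPaths n)

returns-zero-suc : ∀ n → returns 0 (suc n) ≡ returns 1 n
returns-zero-suc n =
  trans (count-allPaths-suc n _) (trans (cong (_+_ (returns 1 n)) (count-false (allPaths n) (λ _ → refl)))
                                        (+-identityʳ (returns 1 n)))

returns-suc-suc : ∀ h n → returns (suc h) (suc n) ≡ returns (suc (suc h)) n + returns h n
returns-suc-suc h n =
  trans (count-allPaths-suc n _) (cong (λ h′ → returns h′ n + returns h n) (+-comm (suc h) 1))

returns≡shift-^∗-upTo : ∀ n → (∀ i → i ≤ n → E i ≡ catalanMap E i) →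
                        ∀ h m → m ≤ n → returns h m ≡ shift h (E ^∗ suc h) m
returns≡shift-^∗-upTo n E≡ zero m _ = sym (∗-identityʳ E m)
returns≡shift-^∗-upTo n E≡ (suc h) zero _ = refl
returns≡shift-^∗-upTo n E≡ (suc h) (suc m) 1+m≤n = begin
  returns (suc h) (suc m)                                         ≡⟨ returns-suc-suc h m ⟩
  returns (2 + h) m + returns h m                                 ≡⟨ cong₂ _+_ (IH (2 + h)) (IH h) ⟩
  shift (2 + h) (E ^∗ (3 + h)) m + shift h (E ^∗ suc h) m         ≡⟨ +-comm _ (shift h (E ^∗ suc h) m) ⟩
  shift h (E ^∗ suc h) m + shift (2 + h) (E ^∗ (3 + h)) m
    ≡⟨ cong (_+_ (shift h (E ^∗ suc h) m)) (sym (shift-shift-comm m)) ⟩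
  shift h (E ^∗ suc h) m + shift h (shift 2 (E ^∗ (3 + h))) m     ≡⟨ sym (shift-⊕ h _ _ m) ⟩
  shift h (E ^∗ suc h ⊕ shift 2 (E ^∗ (3 + h))) m
    ≡⟨ sym (shift-cong-upTo h m (λ i i≤m → ^∗-step-upTo E i (catalan-upTo i i≤m) (suc h))) ⟩
  shift h (E ^∗ (2 + h)) m                                        ∎
  where
  open ≡-Reasoning
  m≤n : m ≤ n
  m≤n = ≤-trans (n≤1+n m) 1+m≤n
  IH : ∀ h′ → returns h′ m ≡ shift h′ (E ^∗ suc h′) m
  IH h′ = returns≡shift-^∗-upTo n E≡ h′ m m≤n
  shift-shift-comm : shift h (shift 2 (E ^∗ (3 + h))) ≗ shift (2 + h) (E ^∗ (3 + h))
  shift-shift-comm i = trans (shift-shift h 2 _ i) (cong (λ k → shift k (E ^∗ (3 + h)) i) (+-comm h 2))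
  catalan-upTo : ∀ i → i ≤ m → ∀ j → j ≤ i → E j ≡ catalanMap E j
  catalan-upTo i i≤m j j≤i = E≡ j (≤-trans j≤i (≤-trans i≤m m≤n))

-- The equation at length n + 1 needs the formula for returns only up to length n.
E-catalan-upTo : ∀ n i → i ≤ n → E i ≡ catalanMap E i
E-catalan-upTo zero .zero z≤n = refl
E-catalan-upTo (suc n) i i≤1+n with m≤n⇒m<n∨m≡n i≤1+n
... | inj₁ (s≤s i≤n) = E-catalan-upTo n i i≤n
... | inj₂ refl = begin
  E (suc n)              ≡⟨ returns-zero-suc n ⟩
  returns 1 n            ≡⟨ returns≡shift-^∗-upTo n (E-catalan-upTo n) 1 n ≤-refl ⟩
  shift 1 (E ^∗ 2) n     ≡⟨ shift-cong 1 (∗-cong {f = E} (λ _ → refl) (∗-identityʳ E)) n ⟩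
  catalanMap E (suc n)   ∎
  where open ≡-Reasoning

E-catalan : E ≗ catalanMap E
E-catalan n = E-catalan-upTo n n ≤-refl

E^∗-step : ∀ p → E ^∗ suc p ≗ E ^∗ p ⊕ shift 2 (E ^∗ suc (suc p))
E^∗-step p n = ^∗-step-upTo E n (λ i _ → E-catalan i) p

mono : ℕ → ℕ → ℕ → Series
mono c m p = c · shift m (E ^∗ p)

mono-cong : ∀ {c c′ m m′ p p′} → c ≡ c′ → m ≡ m′ → p ≡ p′ → mono c m p ≗ mono c′ m′ p′
mono-cong refl refl refl n = refl

mono-double : ∀ c m p n → mono c m p n + mono c m p n ≡ mono (2 * c) m p n
mono-double c m p n =
  sym (trans (*-assoc 2 c _) (cong (_+_ (mono c m p n)) (+-identityʳ (mono c m p n))))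

mono-∗ : ∀ c m p c′ m′ p′ → mono c m p ∗ mono c′ m′ p′ ≗ mono (c * c′) (m + m′) (p + p′)
mono-∗ c m p c′ m′ p′ n = begin
  (mono c m p ∗ mono c′ m′ p′) n
    ≡⟨ ∗-scaleˡ c (shift m (E ^∗ p)) (mono c′ m′ p′) n ⟩
  c * (shift m (E ^∗ p) ∗ mono c′ m′ p′) n
    ≡⟨ cong (c *_) (∗-scaleʳ c′ (shift m (E ^∗ p)) (shift m′ (E ^∗ p′)) n) ⟩
  c * (c′ * (shift m (E ^∗ p) ∗ shift m′ (E ^∗ p′)) n)
    ≡⟨ sym (*-assoc c c′ _) ⟩
  c * c′ * (shift m (E ^∗ p) ∗ shift m′ (E ^∗ p′)) n
    ≡⟨ cong (c * c′ *_) (shift-∗-shift m m′ (E ^∗ p) (E ^∗ p′) n) ⟩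
  c * c′ * shift (m + m′) (E ^∗ p ∗ E ^∗ p′) n
    ≡⟨ cong (c * c′ *_) (shift-cong (m + m′) (^∗-+ E p p′) n) ⟩
  mono (c * c′) (m + m′) (p + p′) n ∎
  where open ≡-Reasoning

mono-step : ∀ c m p → mono c m (suc p) ≗ mono c m p ⊕ mono c (2 + m) (2 + p)
mono-step c m p n = begin
  c * shift m (E ^∗ suc p) n
    ≡⟨ cong (c *_) (shift-cong m (E^∗-step p) n) ⟩
  c * shift m (E ^∗ p ⊕ shift 2 (E ^∗ (2 + p))) n
    ≡⟨ cong (c *_) (shift-⊕ m _ _ n) ⟩
  c * (shift m (E ^∗ p) n + shift m (shift 2 (E ^∗ (2 + p))) n)
    ≡⟨ cong (λ k → c * (shift m (E ^∗ p) n + k)) (shift-shift m 2 _ n) ⟩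
  c * (shift m (E ^∗ p) n + shift (m + 2) (E ^∗ (2 + p)) n)
    ≡⟨ cong (λ k → c * (shift m (E ^∗ p) n + shift k (E ^∗ (2 + p)) n)) (+-comm m 2) ⟩
  c * (shift m (E ^∗ p) n + shift (2 + m) (E ^∗ (2 + p)) n)
    ≡⟨ *-distribˡ-+ c _ _ ⟩
  mono c m p n + mono c (2 + m) (2 + p) n ∎
  where open ≡-Reasoning

-- Paths by final height and by N

natEq-cong-⇔ : ∀ {a b a′ b′} → (a ≡ b → a′ ≡ b′) → (a′ ≡ b′ → a ≡ b) → natEq a b ≡ natEq a′ b′
natEq-cong-⇔ {a} {b} {a′} {b′} to from with a ℕ.≟ b | a′ ℕ.≟ b′
... | yes _ | yes _ = refl
... | no _ | no _ = refl
... | yes a≡b | no a′≢b′ = ⊥-elim (a′≢b′ (to a≡b))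
... | no a≢b | yes a′≡b′ = ⊥-elim (a≢b (from a′≡b′))

natEq-≢ : ∀ {a b} → a ≢ b → natEq a b ≡ false
natEq-≢ {a} {b} a≢b with a ℕ.≟ b
... | yes a≡b = ⊥-elim (a≢b a≡b)
... | no _ = refl

isHeight-cong-⇔ : ∀ {a b a′ b′} → (a ≡ b → a′ ≡ b′) → (a′ ≡ b′ → a ≡ b) →
                  isHeight a b ≡ isHeight a′ b′
isHeight-cong-⇔ {a} {b} {a′} {b′} to from with a ℤ.≟ b | a′ ℤ.≟ b′
... | yes _ | yes _ = refl
... | no _ | no _ = refl
... | yes a≡b | no a′≢b′ = ⊥-elim (a′≢b′ (to a≡b))
... | no a≢b | yes a′≡b′ = ⊥-elim (a≢b (from a′≡b′))

isHeight-∧-subst : ∀ e t (F : ℤ → Bool) → (isHeight e t ∧ F e) ≡ (isHeight e t ∧ F t)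
isHeight-∧-subst e t F with e ℤ.≟ t
... | yes refl = refl
... | no _ = refl

isHeight-+1 : ∀ e t → isHeight (e ℤ.+ + 1) t ≡ isHeight e (ℤ.pred t)
isHeight-+1 e t = isHeight-cong-⇔
  (λ e+1≡t → trans (sym (ℤ.pred-suc e)) (cong ℤ.pred (trans (ℤ.+-comm (+ 1) e) e+1≡t)))
  (λ e≡pred-t → trans (ℤ.+-comm e (+ 1)) (trans (cong ℤ.suc e≡pred-t) (ℤ.suc-pred t)))

isHeight-−1 : ∀ e t → isHeight (e ℤ.+ -[1+ 0 ]) t ≡ isHeight e (ℤ.suc t)
isHeight-−1 e t = isHeight-cong-⇔
  (λ e−1≡t → trans (sym (ℤ.suc-pred e)) (cong ℤ.suc (trans (ℤ.+-comm -[1+ 0 ] e) e−1≡t)))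
  (λ e≡suc-t → trans (ℤ.+-comm e -[1+ 0 ]) (trans (cong ℤ.pred e≡suc-t) (ℤ.pred-suc t)))

endFrom-∷ʳ : ∀ h p s → endFrom h (p ∷ʳ s) ≡ endFrom h p ℤ.+ stepVal s
endFrom-∷ʳ h [] s = refl
endFrom-∷ʳ h (s′ ∷ p) s = endFrom-∷ʳ (h ℤ.+ stepVal s′) p s

NFrom-∷ʳ-up : ∀ h p → NFrom h (p ∷ʳ up) ≡ NFrom h p
NFrom-∷ʳ-up h [] = refl
NFrom-∷ʳ-up h (up ∷ p) = NFrom-∷ʳ-up (h ℤ.+ + 1) p
NFrom-∷ʳ-up h (down ∷ p) = cong (_+_ (ind (isMinus1or2 (h ℤ.- + 1)))) (NFrom-∷ʳ-up (h ℤ.- + 1) p)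

NFrom-∷ʳ-down : ∀ h p →
  NFrom h (p ∷ʳ down) ≡ NFrom h p + ind (isMinus1or2 (endFrom h p ℤ.+ -[1+ 0 ]))
NFrom-∷ʳ-down h [] = +-comm (ind (isMinus1or2 (h ℤ.- + 1))) 0
NFrom-∷ʳ-down h (up ∷ p) = NFrom-∷ʳ-down (h ℤ.+ + 1) p
NFrom-∷ʳ-down h (down ∷ p) =
  trans (cong (_+_ (ind (isMinus1or2 (h ℤ.- + 1)))) (NFrom-∷ʳ-down (h ℤ.- + 1) p))
        (sym (+-assoc (ind (isMinus1or2 (h ℤ.- + 1))) _ _))

count-natEq-+ind : ∀ {A : Set} b (H : A → Bool) (M : A → ℕ) xs k →
  count (λ x → H x ∧ natEq (M x + ind b) k) xs
    ≡ shift (ind b) (λ k′ → count (λ x → H x ∧ natEq (M x) k′) xs) k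
count-natEq-+ind false H M xs k =
  count-cong xs (λ x → cong (λ m → H x ∧ natEq m k) (+-identityʳ (M x)))
count-natEq-+ind true H M xs zero = count-false xs (λ x →
  trans (cong (H x ∧_) (natEq-≢ (λ Mx+1≡0 → 1+n≢0 (trans (+-comm 1 (M x)) Mx+1≡0)))) (∧-zeroʳ (H x)))
count-natEq-+ind true H M xs (suc k) = count-cong xs (λ x → cong (H x ∧_) (natEq-cong-⇔
  (λ Mx+1≡1+k → suc-injective (trans (+-comm 1 (M x)) Mx+1≡1+k))
  (λ Mx≡k → trans (+-comm (M x) 1) (cong suc Mx≡k))))

paths : ℤ → ℕ → ℕ → ℕ
paths t n k = count (λ p → isHeight (endHeight p) t ∧ natEq (N p) k) (allPaths n)

-- A path ending at t arrives from t - 1 by an up step, or from t + 1 by a down step;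
-- only the down step can count towards N, and it does exactly when t ∈ {-1, -2}.
paths-suc : ∀ t n k →
  paths t (suc n) k ≡ paths (ℤ.pred t) n k + shift (ind (isMinus1or2 t)) (paths (ℤ.suc t) n) k
paths-suc t n k = begin
  paths t (suc n) k
    ≡⟨ count-allPaths-∷ʳ n P ⟩
  count (λ p → P (p ∷ʳ up)) ps + count (λ p → P (p ∷ʳ down)) ps
    ≡⟨ cong₂ _+_ (count-cong ps last-up) (count-cong ps last-down) ⟩
  paths (ℤ.pred t) n k + count (λ p → above p ∧ natEq (N p + ind (isMinus1or2 t)) k) ps
    ≡⟨ cong (_+_ (paths (ℤ.pred t) n k)) (count-natEq-+ind (isMinus1or2 t) above N ps k) ⟩
  paths (ℤ.pred t) n k + shift (ind (isMinus1or2 t)) (paths (ℤ.suc t) n) k ∎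
  where
  open ≡-Reasoning
  ps : List Path
  ps = allPaths n
  P : Path → Bool
  P p = isHeight (endHeight p) t ∧ natEq (N p) k
  above : Path → Bool
  above p = isHeight (endHeight p) (ℤ.suc t)
  last-up : ∀ p → P (p ∷ʳ up) ≡ (isHeight (endHeight p) (ℤ.pred t) ∧ natEq (N p) k)
  last-up p = cong₂ _∧_
    (trans (cong (λ e → isHeight e t) (endFrom-∷ʳ (+ 0) p up)) (isHeight-+1 (endHeight p) t))
    (cong (λ m → natEq m k) (NFrom-∷ʳ-up (+ 0) p))
  last-down : ∀ p → P (p ∷ʳ down) ≡ (above p ∧ natEq (N p + ind (isMinus1or2 t)) k)
  last-down p = begin
    P (p ∷ʳ down)
      ≡⟨ cong₂ _∧_ (trans (cong (λ e → isHeight e t) (endFrom-∷ʳ (+ 0) p down))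
                          (isHeight-−1 (endHeight p) t))
                   (cong (λ m → natEq m k) (NFrom-∷ʳ-down (+ 0) p)) ⟩
    above p ∧ natEq (N p + ind (isMinus1or2 (endHeight p ℤ.+ -[1+ 0 ]))) k
      ≡⟨ isHeight-∧-subst (endHeight p) (ℤ.suc t)
           (λ e → natEq (N p + ind (isMinus1or2 (e ℤ.+ -[1+ 0 ]))) k) ⟩
    above p ∧ natEq (N p + ind (isMinus1or2 (ℤ.suc t ℤ.+ -[1+ 0 ]))) k
      ≡⟨ cong (λ s → above p ∧ natEq (N p + ind (isMinus1or2 s)) k)
              (trans (ℤ.+-comm (ℤ.suc t) -[1+ 0 ]) (ℤ.pred-suc t)) ⟩
    above p ∧ natEq (N p + ind (isMinus1or2 t)) k ∎

-- closedForm t k = Σₙ paths t n k zⁿ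
closedForm : ℤ → ℕ → Series
closedForm (+ s) zero = mono 1 s (suc s)
closedForm (+ s) (suc j) = mono (2 ^ j) (2 + s + 2 * j) (2 + s + j)
closedForm -[1+ 0 ] zero = λ _ → 0
closedForm -[1+ 0 ] (suc j) = mono (2 ^ j) (1 + 2 * j) (1 + j)
closedForm -[1+ suc s ] zero = λ _ → 0
closedForm -[1+ suc s ] (suc zero) = λ _ → 0
closedForm -[1+ suc s ] (suc (suc j)) = mono (2 ^ j) (2 + s + 2 * j) (2 + s + j)

paths-zero : ∀ t k → paths t 0 k ≡ closedForm t k 0
paths-zero (+ zero) zero = refl
paths-zero (+ zero) (suc j) = sym (*-zeroʳ (2 ^ j))
paths-zero (+ suc s) zero = refl
paths-zero (+ suc s) (suc j) = sym (*-zeroʳ (2 ^ j))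
paths-zero -[1+ 0 ] zero = refl
paths-zero -[1+ 0 ] (suc j) = sym (*-zeroʳ (2 ^ j))
paths-zero -[1+ suc s ] zero = refl
paths-zero -[1+ suc s ] (suc zero) = refl
paths-zero -[1+ suc s ] (suc (suc j)) = sym (*-zeroʳ (2 ^ j))

closedForm-suc : ∀ t k n →
  closedForm t k (suc n)
    ≡ closedForm (ℤ.pred t) k n + shift (ind (isMinus1or2 t)) (λ k′ → closedForm (ℤ.suc t) k′ n) k
closedForm-suc (+ zero) zero n = mono-step 1 0 0 (suc n)
closedForm-suc (+ zero) (suc j) n = mono-step (2 ^ j) (1 + 2 * j) (1 + j) n
closedForm-suc (+ suc s) zero n = mono-step 1 s (suc s) n
closedForm-suc (+ suc s) (suc j) n = mono-step (2 ^ j) (2 + s + 2 * j) (2 + s + j) n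
closedForm-suc -[1+ 0 ] zero n = refl
closedForm-suc -[1+ 0 ] (suc zero) n = refl
closedForm-suc -[1+ 0 ] (suc (suc j)) n =
  trans (mono-cong {c = 2 ^ suc j} {p = 2 + j} refl (*-suc 2 j) refl n)
        (sym (mono-double (2 ^ j) (2 + 2 * j) (2 + j) n))
closedForm-suc -[1+ 1 ] zero n = refl
closedForm-suc -[1+ 1 ] (suc zero) n = refl
closedForm-suc -[1+ 1 ] (suc (suc j)) n =
  trans (mono-step (2 ^ j) (1 + 2 * j) (1 + j) n) (+-comm (mono (2 ^ j) (1 + 2 * j) (1 + j) n) _)
closedForm-suc -[1+ suc (suc s) ] zero n = refl
closedForm-suc -[1+ suc (suc s) ] (suc zero) n = refl
closedForm-suc -[1+ suc (suc s) ] (suc (suc j)) n =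
  trans (mono-step (2 ^ j) (2 + s + 2 * j) (2 + s + j) n)
        (+-comm (mono (2 ^ j) (2 + s + 2 * j) (2 + s + j) n) _)

paths≡closedForm : ∀ n t k → paths t n k ≡ closedForm t k n
paths≡closedForm zero t k = paths-zero t k
paths≡closedForm (suc n) t k = begin
  paths t (suc n) k
    ≡⟨ paths-suc t n k ⟩
  paths (ℤ.pred t) n k + shift (ind (isMinus1or2 t)) (paths (ℤ.suc t) n) k
    ≡⟨ cong₂ _+_ (paths≡closedForm n (ℤ.pred t) k)
                 (shift-cong (ind (isMinus1or2 t)) (paths≡closedForm n (ℤ.suc t)) k) ⟩
  closedForm (ℤ.pred t) k n + shift (ind (isMinus1or2 t)) (λ k′ → closedForm (ℤ.suc t) k′ n) k
    ≡⟨ sym (closedForm-suc t k n) ⟩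
  closedForm t k (suc n) ∎
  where open ≡-Reasoning

-- Coefficients of the right-hand side

record QMonomial (F : FPS2) (a : ℕ) (f : Series) : Set where
  field
    coeff-at  : ∀ n → F n a ≡ f n
    coeff-off : ∀ n k → k ≢ a → F n k ≡ 0
open QMonomial

QMonomial-resp : ∀ {F a b f g} → a ≡ b → f ≗ g → QMonomial F a f → QMonomial F b g
QMonomial-resp refl f≗g F-mono = record
  { coeff-at = λ n → trans (coeff-at F-mono n) (f≗g n)
  ; coeff-off = coeff-off F-mono
  }

⊛-QMonomialˡ-at : ∀ {F a f} → QMonomial F a f → ∀ Y n k → (F ⊛ Y) n (a + k) ≡ (f ∗ (λ i → Y i k)) n
⊛-QMonomialˡ-at {F} {a} {f} F-mono Y n k = sumTo-cong n λ i _ → begin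
  sumTo (a + k) (λ j → F i j * Y (n ∸ i) (a + k ∸ j))
    ≡⟨ sumTo-single (a + k) a (m≤m+n a k)
         (λ j _ j≢a → cong (_* Y (n ∸ i) (a + k ∸ j)) (coeff-off F-mono i j j≢a)) ⟩
  F i a * Y (n ∸ i) (a + k ∸ a)
    ≡⟨ cong₂ (λ c k′ → c * Y (n ∸ i) k′) (coeff-at F-mono i) (m+n∸m≡n a k) ⟩
  f i * Y (n ∸ i) k ∎
  where open ≡-Reasoning

⊛-QMonomialˡ-below : ∀ {F a f} → QMonomial F a f → ∀ Y n k → k < a → (F ⊛ Y) n k ≡ 0
⊛-QMonomialˡ-below {F} F-mono Y n k k<a = sumTo-zero n λ i _ → sumTo-zero k λ j j≤k →
  cong (_* Y (n ∸ i) (k ∸ j)) (coeff-off F-mono i j (λ { refl → <⇒≱ k<a j≤k }))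

⊛-QMonomial : ∀ {F G a b f g} → QMonomial F a f → QMonomial G b g → QMonomial (F ⊛ G) (a + b) (f ∗ g)
⊛-QMonomial {F} {G} {a} {b} {f} {g} F-mono G-mono = record
  { coeff-at = λ n → trans (⊛-QMonomialˡ-at F-mono G n b) (∗-cong {f = f} (λ _ → refl) (coeff-at G-mono) n)
  ; coeff-off = off
  }
  where
  off : ∀ n k → k ≢ a + b → (F ⊛ G) n k ≡ 0
  off n k k≢a+b with a ℕ.≤? k
  ... | no a≰k = ⊛-QMonomialˡ-below F-mono G n k (≰⇒> a≰k)
  ... | yes a≤k = subst (λ k′ → (F ⊛ G) n k′ ≡ 0) (m+[n∸m]≡n a≤k)
    (trans (⊛-QMonomialˡ-at F-mono G n (k ∸ a)) (sumTo-zero n λ i _ →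
      trans (cong (f i *_) (coeff-off G-mono (n ∸ i) (k ∸ a) k∸a≢b)) (*-zeroʳ (f i))))
    where
    k∸a≢b : k ∸ a ≢ b
    k∸a≢b k∸a≡b = k≢a+b (trans (sym (m+[n∸m]≡n a≤k)) (cong (_+_ a) k∸a≡b))

one-QMonomial : QMonomial one 0 δ
one-QMonomial = record { coeff-at = at ; coeff-off = off }
  where
  at : ∀ n → one n 0 ≡ δ n
  at zero = refl
  at (suc n) = refl
  off : ∀ n k → k ≢ 0 → one n k ≡ 0
  off zero zero k≢0 = ⊥-elim (k≢0 refl)
  off zero (suc k) _ = refl
  off (suc n) k _ = refl

^ₛ-QMonomial : ∀ {F a f} → QMonomial F a f → ∀ m → QMonomial (F ^ₛ m) (m * a) (f ^∗ m)
^ₛ-QMonomial F-mono zero = one-QMonomial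
^ₛ-QMonomial F-mono (suc m) = ⊛-QMonomial F-mono (^ₛ-QMonomial F-mono m)

⊛-QMonomial₀ʳ : ∀ {G g} → QMonomial G 0 g → ∀ Y n k → (Y ⊛ G) n k ≡ ((λ i → Y i k) ∗ g) n
⊛-QMonomial₀ʳ {G} {g} G-mono Y n k = sumTo-cong n λ i _ → begin
  sumTo k (λ j → Y i j * G (n ∸ i) (k ∸ j))
    ≡⟨ sumTo-single k k ≤-refl (λ j j≤k j≢k →
         trans (cong (Y i j *_) (coeff-off G-mono (n ∸ i) (k ∸ j)
                                   (λ k∸j≡0 → j≢k (≤-antisym j≤k (m∸n≡0⇒m≤n k∸j≡0)))))
               (*-zeroʳ (Y i j))) ⟩
  Y i k * G (n ∸ i) (k ∸ k)
    ≡⟨ cong (λ k′ → Y i k * G (n ∸ i) k′) (n∸n≡0 k) ⟩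
  Y i k * G (n ∸ i) 0
    ≡⟨ cong (Y i k *_) (coeff-at G-mono (n ∸ i)) ⟩
  Y i k * g (n ∸ i) ∎
  where open ≡-Reasoning

^∗-below : ∀ {w} → w 0 ≡ 0 → ∀ k n → n < k → (w ^∗ k) n ≡ 0
^∗-below {w} w₀≡0 (suc k) n (s≤s n≤k) = sumTo-zero n vanishes
  where
  vanishes : ∀ i → i ≤ n → w i * (w ^∗ k) (n ∸ i) ≡ 0
  vanishes zero _ = cong (_* (w ^∗ k) n) w₀≡0
  vanishes (suc i) 1+i≤n =
    trans (cong (w (suc i) *_) (^∗-below w₀≡0 k (n ∸ suc i) (<-≤-trans (∸-monoʳ-< z<s 1+i≤n) n≤k)))
          (*-zeroʳ (w (suc i)))

geom-coeff : ∀ {X w} → QMonomial X 1 w → w 0 ≡ 0 → ∀ n k → geom X n k ≡ (w ^∗ k) n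
geom-coeff {X} {w} X-mono w₀≡0 n k = by-cases (k ℕ.≤? n)
  where
  powers : ∀ j → QMonomial (X ^ₛ j) j (w ^∗ j)
  powers j = QMonomial-resp (*-identityʳ j) (λ _ → refl) (^ₛ-QMonomial X-mono j)
  by-cases : Dec (k ≤ n) → geom X n k ≡ (w ^∗ k) n
  by-cases (yes k≤n) =
    trans (sumTo-single n k k≤n λ j _ j≢k → coeff-off (powers j) n k (λ k≡j → j≢k (sym k≡j)))
          (coeff-at (powers k) n)
  by-cases (no k≰n) =
    trans (sumTo-zero n λ j j≤n → coeff-off (powers j) n k (λ { refl → k≰n j≤n }))
          (sym (^∗-below w₀≡0 k n (≰⇒> k≰n)))

mono-^∗ : ∀ c m p j → mono c m p ^∗ j ≗ mono (c ^ j) (j * m) (j * p)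
mono-^∗ c m p zero n = sym (+-identityʳ (δ n))
mono-^∗ c m p (suc j) n =
  trans (∗-cong {f = mono c m p} (λ _ → refl) (mono-^∗ c m p j) n) (mono-∗ c m p (c ^ j) (j * m) (j * p) n)

zE-QMonomial : QMonomial zE 0 (mono 1 1 1)
zE-QMonomial = record { coeff-at = at ; coeff-off = off }
  where
  at : ∀ n → zE n 0 ≡ mono 1 1 1 n
  at zero = refl
  at (suc n) = sym (trans (+-identityʳ _) (∗-identityʳ E n))
  off : ∀ n k → k ≢ 0 → zE n k ≡ 0
  off zero k _ = refl
  off (suc n) zero k≢0 = ⊥-elim (k≢0 refl)
  off (suc n) (suc k) _ = refl

twoZ²qE-QMonomial : QMonomial twoZ²qE 1 (mono 2 2 1)
twoZ²qE-QMonomial = record { coeff-at = at ; coeff-off = off }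
  where
  at : ∀ n → twoZ²qE n 1 ≡ mono 2 2 1 n
  at zero = refl
  at (suc zero) = refl
  at (suc (suc n)) = cong (2 *_) (sym (∗-identityʳ E n))
  off : ∀ n k → k ≢ 1 → twoZ²qE n k ≡ 0
  off zero k _ = refl
  off (suc zero) k _ = refl
  off (suc (suc n)) zero _ = refl
  off (suc (suc n)) (suc zero) k≢1 = ⊥-elim (k≢1 refl)
  off (suc (suc n)) (suc (suc k)) _ = refl

q²-QMonomial : QMonomial q² 2 δ
q²-QMonomial = record { coeff-at = at ; coeff-off = off }
  where
  at : ∀ n → q² n 2 ≡ δ n
  at zero = refl
  at (suc n) = refl
  off : ∀ n k → k ≢ 2 → q² n k ≡ 0
  off zero zero _ = refl
  off zero (suc zero) _ = refl
  off zero (suc (suc zero)) k≢2 = ⊥-elim (k≢2 refl)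
  off zero (suc (suc (suc k))) _ = refl
  off (suc n) k _ = refl

zE^ₛ-QMonomial : ∀ d → QMonomial (zE ^ₛ d) 0 (mono 1 d d)
zE^ₛ-QMonomial d = QMonomial-resp (*-zeroʳ d)
  (λ n → trans (mono-^∗ 1 1 1 d n) (mono-cong (^-zeroˡ d) (*-identityʳ d) (*-identityʳ d) n))
  (^ₛ-QMonomial zE-QMonomial d)

q²geom-coeff : ∀ n j → (q² ⊛ geom twoZ²qE) n (2 + j) ≡ mono (2 ^ j) (j * 2) (j * 1) n
q²geom-coeff n j = begin
  (q² ⊛ geom twoZ²qE) n (2 + j)          ≡⟨ ⊛-QMonomialˡ-at q²-QMonomial (geom twoZ²qE) n j ⟩
  (δ ∗ (λ i → geom twoZ²qE i j)) n       ≡⟨ ∗-identityˡ (λ i → geom twoZ²qE i j) n ⟩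
  geom twoZ²qE n j                        ≡⟨ geom-coeff twoZ²qE-QMonomial refl n j ⟩
  (mono 2 2 1 ^∗ j) n                     ≡⟨ mono-^∗ 2 2 1 j n ⟩
  mono (2 ^ j) (j * 2) (j * 1) n          ∎
  where open ≡-Reasoning

RHS≡closedForm : ∀ s n k → RHS (2 + s) n k ≡ closedForm -[1+ suc s ] k n
RHS≡closedForm s n k =
  trans (⊛-QMonomial₀ʳ (zE^ₛ-QMonomial d) (q² ⊛ geom twoZ²qE) n k) (by-degree k)
  where
  d : ℕ
  d = 2 + s
  below-q² : ∀ k → k < 2 → (λ i → (q² ⊛ geom twoZ²qE) i k) ≗ (λ _ → 0)
  below-q² k k<2 i = ⊛-QMonomialˡ-below q²-QMonomial (geom twoZ²qE) i k k<2
  by-degree : ∀ k → ((λ i → (q² ⊛ geom twoZ²qE) i k) ∗ mono 1 d d) n ≡ closedForm -[1+ suc s ] k n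
  by-degree zero =
    trans (∗-cong {g = mono 1 d d} (below-q² 0 z<s) (λ _ → refl) n) (∗-zeroˡ (mono 1 d d) n)
  by-degree (suc zero) =
    trans (∗-cong {g = mono 1 d d} (below-q² 1 (s≤s z<s)) (λ _ → refl) n) (∗-zeroˡ (mono 1 d d) n)
  by-degree (suc (suc j)) = begin
    ((λ i → (q² ⊛ geom twoZ²qE) i (2 + j)) ∗ mono 1 d d) n
      ≡⟨ ∗-cong {g = mono 1 d d} (λ i → q²geom-coeff i j) (λ _ → refl) n ⟩
    (mono (2 ^ j) (j * 2) (j * 1) ∗ mono 1 d d) n
      ≡⟨ mono-∗ (2 ^ j) (j * 2) (j * 1) 1 d d n ⟩
    mono (2 ^ j * 1) (j * 2 + d) (j * 1 + d) n
      ≡⟨ mono-cong (*-identityʳ (2 ^ j))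
                   (trans (+-comm (j * 2) d) (cong (_+_ d) (*-comm j 2)))
                   (trans (+-comm (j * 1) d) (cong (_+_ d) (*-identityʳ j))) n ⟩
    mono (2 ^ j) (d + 2 * j) (d + j) n ∎
    where open ≡-Reasoning

mainTheorem5 : (d : ℕ) → 2 ≤ d → (n k : ℕ) → G d n k ≡ RHS d n k
mainTheorem5 (suc (suc s)) _ n k = trans (paths≡closedForm n -[1+ suc s ] k) (sym (RHS≡closedForm s n k))
mainTheorem5 1 (s≤s ()) n k
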